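{- Let $\mathbf{A}$ be a non-trivial residuated lattice, $X$ a Boolean space, and $\varphi:\mathbf{C}(X)\to\mathcal{F}_i(\mathbf{A})$ a dual homomorphism. For $x\in X$ let $F_x=\bigvee_{a\in C(x)}\varphi(a)$ (join in $\mathcal{F}_i(\mathbf{A})$). Then for each $x\in X$, $\mathbf{A}/F_x$ is the inductive limit of the system $\langle\{\mathbf{A}/\varphi(a)\}_{a\in C(x)},\{\rho_{ab}\}_{a\subseteq b}\rangle$, and for each $a\in C(X)$, $\bigcap_{x\in a}F_x=\varphi(a)$.
   Context: A residuated lattice is an algebra $(A,\ast,\to,\vee,\wedge,\top)$ with $(A,\ast,\top)$ a commutative monoid, $(A,\vee,\wedge)$ a lattice with top $\top$, and $x\ast y\le z$ iff $x\le y\to z$. An i-filter is a subset $F\ni\top$ with $x,x\to y\in F\Rightarrow y\in F$; $\mathcal{F}_i(\mathbf{A})$ is the lattice of i-filters under inclusion (meet is intersection, join is the i-filter generated by the union, bottom $\{\top\}$, top $A$). For an i-filter $F$, $\mathbf{A}/F$ is the quotient by the congruence $u\equiv v$ iff $(u\to v)\ast(v\to u)\in F$. A Boolean space is a compact Hausdorff totally disconnected space; $\mathbf{C}(X)$ is the Boolean algebra of clopen subsets of $X$ and $C(x)=\{a\in C(X):x\in a\}$. A dual homomorphism $\varphi$ satisfies $\varphi(a\cap b)=\varphi(a)\vee\varphi(b)$, $\varphi(a\cup b)=\varphi(a)\cap\varphi(b)$, $\varphi(\emptyset)=A$, $\varphi(X)=\{\top\}$. For $a\subseteq b$ in $C(X)$,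 $\rho_{ab}:\mathbf{A}/\varphi(b)\to\mathbf{A}/\varphi(a)$ is the natural homomorphism (well defined since $\varphi(b)\subseteq\varphi(a)$). -}

module Defs where

open import Level using (Level; Lift; lift) renaming (zero to 0ℓ; suc to lsuc)
open import Algebra.Core using (Op₂)
open import Algebra.Definitions using (Congruent₂)
open import Algebra.Structures using (IsCommutativeMonoid)
open import Algebra.Lattice.Structures using (IsLattice)
open import Relation.Binary.Core using (Rel)
open import Relation.Binary.PropositionalEquality using (_≡_)
open import Relation.Nullary using (¬_)
open import Data.Product using (Σ; ∃; _×_; _,_; proj₁; proj₂)
open import Data.Sum using (_⊎_)
open import Data.Empty using (⊥)
open import Data.List using (List)
open import Data.List.Relation.Unary.Any using (Any)
open import Data.Unit using () renaming (⊤ to Unit)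

record ResLattice : Set₁ where
  infixr 7 _*_
  infixr 5 _⇒_
  infixr 6 _∨_ _∧_
  infix 4 _≈_ _≤_
  field
    Carrier : Set
    _≈_     : Rel Carrier 0ℓ
    _*_ _⇒_ _∨_ _∧_ : Op₂ Carrier
    ⊤       : Carrier
    *-isCommutativeMonoid : IsCommutativeMonoid _≈_ _*_ ⊤
    ∨∧-isLattice          : IsLattice _≈_ _∨_ _∧_
    ⇒-cong  : Congruent₂ _≈_ _⇒_

  _≤_ : Rel Carrier 0ℓ
  x ≤ y = (x ∧ y) ≈ x

  field
    ⊤-top       : ∀ x → x ≤ ⊤
    residuated₁ : ∀ x y z → (x * y) ≤ z → x ≤ (y ⇒ z)
    residuated₂ : ∀ x y z → x ≤ (y ⇒ z) → (x * y) ≤ z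

  NonTrivial : Set
  NonTrivial = Σ Carrier (λ x → ¬ (x ≈ ⊤))

module _ (A : ResLattice) where
  open ResLattice A

  Subset : Set₂
  Subset = Carrier → Set₁

  record IFilter : Set₂ where
    field
      mem    : Subset
      mem-≈  : ∀ {u v} → u ≈ v → mem u → mem v
      mem-⊤  : mem ⊤
      mem-mp : ∀ {u v} → mem u → mem (u ⇒ v) → mem v

  _⊆F_ : IFilter → IFilter → Set₁
  F ⊆F G = ∀ u → IFilter.mem F u → IFilter.mem G u

  _≐F_ : IFilter → IFilter → Set₁
  F ≐F G = (F ⊆F G) × (G ⊆F F)

  data Gen (S : Subset) : Subset where
    gen-base : ∀ {u} → S u → Gen S u
    gen-≈    : ∀ {u v} → u ≈ v → Gen S u → Gen S v
    gen-⊤    : Gen S ⊤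
    gen-mp   : ∀ {u v} → Gen S u → Gen S (u ⇒ v) → Gen S v

  GenF : Subset → IFilter
  GenF S = record { mem = Gen S ; mem-≈ = gen-≈ ; mem-⊤ = gen-⊤ ; mem-mp = gen-mp }

  ⋁F : {I : Set₁} → (I → IFilter) → IFilter
  ⋁F {I} F = GenF (λ u → Σ I (λ i → IFilter.mem (F i) u))

  _∨F_ : IFilter → IFilter → IFilter
  F ∨F G = GenF (λ u → IFilter.mem F u ⊎ IFilter.mem G u)

  _≡[_]_ : Carrier → IFilter → Carrier → Set₁
  u ≡[ F ] v = IFilter.mem F ((u ⇒ v) * (v ⇒ u))

record Hom (A B : ResLattice) : Set where
  private
    module A = ResLattice A
    module B = ResLattice B
  field
    ⟦_⟧   : A.Carrier → B.Carrier
    cong  : ∀ {u v} → u A.≈ v → ⟦ u ⟧ B.≈ ⟦ v ⟧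
    hom-* : ∀ u v → ⟦ u A.* v ⟧ B.≈ (⟦ u ⟧ B.* ⟦ v ⟧)
    hom-⇒ : ∀ u v → ⟦ u A.⇒ v ⟧ B.≈ (⟦ u ⟧ B.⇒ ⟦ v ⟧)
    hom-∨ : ∀ u v → ⟦ u A.∨ v ⟧ B.≈ (⟦ u ⟧ B.∨ ⟦ v ⟧)
    hom-∧ : ∀ u v → ⟦ u A.∧ v ⟧ B.≈ (⟦ u ⟧ B.∧ ⟦ v ⟧)
    hom-⊤ : ⟦ A.⊤ ⟧ B.≈ B.⊤

-- Elements of A/F are represented by elements of A
-- (A/F is the setoid (A, ≡[F])), so a homomorphism A/F → B is a homomorphism
-- A → B which is constant on the classes of the congruence determined by F.
-- The natural maps A → A/F, rho_ab : A/phi(b) → A/phi(a) and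
-- A/phi(a) → A/F_x are the identity on representatives.
record QHom (A : ResLattice) (F : IFilter A) (B : ResLattice) : Set₁ where
  field
    hom : Hom A B
    respects : ∀ {u v} → _≡[_]_ A u F v →
               ResLattice._≈_ B (Hom.⟦ hom ⟧ u) (Hom.⟦ hom ⟧ v)
  open Hom hom public

PSet : Set → Set₁
PSet X = X → Set

_≐_ : {X : Set} → PSet X → PSet X → Set
U ≐ V = (∀ x → U x → V x) × (∀ x → V x → U x)

record Topology (X : Set) : Set₂ where
  field
    Open   : PSet X → Set₁
    open-≐ : ∀ {U V : PSet X} → U ≐ V → Open U → Open V
    open-X : Open (λ _ → Unit)
    open-∩ : ∀ {U V} → Open U → Open V → Open (λ x → U x × V x)
    open-⋃ : {I : Set} (U : I → PSet X) → (∀ i → Open (U i)) →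
             Open (λ x → Σ I (λ i → U i x))

module _ {X : Set} (τ : Topology X) where
  open Topology τ

  Compact : Set₁
  Compact = {I : Set} (U : I → PSet X) → (∀ i → Open (U i)) →
            (∀ x → Σ I (λ i → U i x)) →
            Σ (List I) (λ is → ∀ x → Any (λ i → U i x) is)

  Hausdorff : Set₁
  Hausdorff = ∀ x y → ¬ (x ≡ y) →
              Σ (PSet X) (λ U → Σ (PSet X) (λ V →
                Open U × Open V × U x × V y × (∀ z → U z → V z → ⊥)))

  Connected : PSet X → Set₁
  Connected S = ¬ Σ (PSet X) (λ U → Σ (PSet X) (λ V →
                  Open U × Open V ×
                  (∀ z → S z → U z ⊎ V z) ×
                  (∀ z → S z → U z → V z → ⊥) ×
                  Σ X (λ z → S z × U z) × Σ X (λ z → S z × V z)))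

  TotallyDisconnected : Set₁
  TotallyDisconnected = ∀ (S : PSet X) → Connected S → ∀ x y → S x → S y → x ≡ y

  record BooleanSpace : Set₁ where
    field
      compact             : Compact
      hausdorff           : Hausdorff
      totallyDisconnected : TotallyDisconnected

  record Clopen : Set₁ where
    field
      set      : PSet X
      co       : PSet X
      set-open : Open set
      co-open  : Open co
      disjoint : ∀ x → set x → co x → ⊥
      cover    : ∀ x → set x ⊎ co x
  open Clopen public

  _⊆C_ : Clopen → Clopen → Set
  a ⊆C b = ∀ x → set a x → set b x

module _ (A : ResLattice) {X : Set} (τ : Topology X) where
  open ResLattice A
  private
    mem = IFilter.mem {A}

  record DualHom (φ : Clopen τ → IFilter A) : Set₂ where
    field
      dh-∩ : ∀ a b c → set c ≐ (λ x → set a x × set b x) →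
             _≐F_ A (φ c) (_∨F_ A (φ a) (φ b))
      dh-∪ : ∀ a b c → set c ≐ (λ x → set a x ⊎ set b x) →
             ∀ u → (mem (φ c) u → mem (φ a) u × mem (φ b) u) ×
                   (mem (φ a) u × mem (φ b) u → mem (φ c) u)
      dh-∅ : ∀ c → (∀ x → set c x → ⊥) → ∀ u → mem (φ c) u
      dh-X : ∀ c → (∀ x → set c x) →
             ∀ u → (mem (φ c) u → u ≈ ⊤) × (u ≈ ⊤ → mem (φ c) u)

  module _ (φ : Clopen τ → IFilter A) where

    Fx : X → IFilter A
    Fx x = ⋁F A {I = Σ (Clopen τ) (λ a → set a x)} (λ p → φ (proj₁ p))

    record Cocone (x : X) (B : ResLattice) : Set₂ where
      field
        f      : (a : Clopen τ) → set a x → QHom A (φ a) B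
        compat : ∀ a b → _⊆C_ τ a b → (xa : set a x) (xb : set b x) →
                 ∀ u → ResLattice._≈_ B (QHom.⟦ f a xa ⟧ u) (QHom.⟦ f b xb ⟧ u)

    IsInductiveLimit : X → Set₂
    IsInductiveLimit x =
      -- the natural maps A/φ(a) → A/F_x are well defined (cocone)
      (∀ a → set a x → _⊆F_ A (φ a) (Fx x)) ×
      (∀ (B : ResLattice) (c : Cocone x B) →
         Σ (QHom A (Fx x) B) (λ h →
           (∀ a (xa : set a x) u →
              ResLattice._≈_ B (QHom.⟦ h ⟧ u) (QHom.⟦ Cocone.f c a xa ⟧ u)) ×
           (∀ (h' : QHom A (Fx x) B) →
              (∀ a (xa : set a x) u →
                 ResLattice._≈_ B (QHom.⟦ h' ⟧ u) (QHom.⟦ Cocone.f c a xa ⟧ u)) →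
              ∀ u → ResLattice._≈_ B (QHom.⟦ h' ⟧ u) (QHom.⟦ h ⟧ u))))

-- F_x is the directed union of the φ(a), a ∈ C(x): φ is antitone, C(x) is closed
-- under finite intersections and contains X.  Hence every cocone is determined by
-- its component at X, which descends to A/F_x.  For the second claim, if u ∈ F_x
-- for all x ∈ a, then each x ∈ a has a clopen neighbourhood b_x with u ∈ φ(b_x);
-- by compactness finitely many b_x cover a, and u lies in φ of their union, which
-- is contained in φ(a).
module Submission where

open import Defs
open import Data.Product using (Σ; _×_; _,_; proj₁; proj₂)
open import Data.Sum using (_⊎_; inj₁; inj₂)
open import Data.Empty using (⊥; ⊥-elim)
open import Data.Bool using (Bool; true; false)
open import Data.Maybe using (Maybe; just; nothing)
open import Data.List using (List; []; _∷_; map; catMaybes)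
open import Data.List.Relation.Unary.All as All using (All; []; _∷_)
import Data.List.Relation.Unary.All.Properties as All
open import Data.List.Relation.Unary.Any using (Any; here; there)
import Data.List.Relation.Unary.Any.Properties as Any
open import Data.Unit using (tt) renaming (⊤ to Unit)
open import Algebra.Structures using (IsCommutativeMonoid)
open import Relation.Binary.Bundles using (Setoid)
import Relation.Binary.Reasoning.Setoid as SetoidReasoning

carrierSetoid : ResLattice → Setoid _ _
carrierSetoid B = IsCommutativeMonoid.setoid (ResLattice.*-isCommutativeMonoid B)

module ClopenAlgebra {X : Set} (τ : Topology X) where
  open Topology τ

  ∅-open : Open (λ _ → ⊥)
  ∅-open = open-≐ ((λ _ p → ⊥-elim (proj₁ p)) , (λ _ ())) (open-⋃ {I = ⊥} (λ ()) (λ ()))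

  ∪-open : ∀ {U V : PSet X} → Open U → Open V → Open (λ x → U x ⊎ V x)
  ∪-open {U} {V} oU oV = open-≐ (to , from) (open-⋃ W oW)
    where
    W : Bool → PSet X
    W true  = U
    W false = V
    oW : ∀ b → Open (W b)
    oW true  = oU
    oW false = oV
    to : ∀ x → Σ Bool (λ b → W b x) → U x ⊎ V x
    to x (true  , p) = inj₁ p
    to x (false , p) = inj₂ p
    from : ∀ x → U x ⊎ V x → Σ Bool (λ b → W b x)
    from x (inj₁ p) = true  , p
    from x (inj₂ p) = false , p

  fullC : Clopen τ
  fullC = record
    { set = λ _ → Unit ; co = λ _ → ⊥ ; set-open = open-X ; co-open = ∅-open
    ; disjoint = λ _ _ () ; cover = λ _ → inj₁ tt }

  emptyC : Clopen τ
  emptyC = record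
    { set = λ _ → ⊥ ; co = λ _ → Unit ; set-open = ∅-open ; co-open = open-X
    ; disjoint = λ _ () ; cover = λ _ → inj₂ tt }

  _∩C_ : Clopen τ → Clopen τ → Clopen τ
  a ∩C b = record
    { set = λ x → set a x × set b x ; co = λ x → co a x ⊎ co b x
    ; set-open = open-∩ (set-open a) (set-open b) ; co-open = ∪-open (co-open a) (co-open b)
    ; disjoint = disj ; cover = cov }
    where
    disj : ∀ x → set a x × set b x → co a x ⊎ co b x → ⊥
    disj x (p , _) (inj₁ r) = disjoint a x p r
    disj x (_ , q) (inj₂ r) = disjoint b x q r
    cov : ∀ x → (set a x × set b x) ⊎ (co a x ⊎ co b x)
    cov x with cover a x | cover b x
    ... | inj₁ p | inj₁ q = inj₁ (p , q)
    ... | inj₂ r | _      = inj₂ (inj₁ r)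
    ... | inj₁ _ | inj₂ r = inj₂ (inj₂ r)

  _∪C_ : Clopen τ → Clopen τ → Clopen τ
  a ∪C b = record
    { set = λ x → set a x ⊎ set b x ; co = λ x → co a x × co b x
    ; set-open = ∪-open (set-open a) (set-open b) ; co-open = open-∩ (co-open a) (co-open b)
    ; disjoint = disj ; cover = cov }
    where
    disj : ∀ x → set a x ⊎ set b x → co a x × co b x → ⊥
    disj x (inj₁ p) (r , _) = disjoint a x p r
    disj x (inj₂ q) (_ , s) = disjoint b x q s
    cov : ∀ x → (set a x ⊎ set b x) ⊎ (co a x × co b x)
    cov x with cover a x | cover b x
    ... | inj₁ p | _      = inj₁ (inj₁ p)
    ... | inj₂ _ | inj₁ q = inj₁ (inj₂ q)
    ... | inj₂ r | inj₂ s = inj₂ (r , s)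

  ⋃C : List (Clopen τ) → Clopen τ
  ⋃C []       = emptyC
  ⋃C (b ∷ bs) = b ∪C ⋃C bs

  ∈⋃C : ∀ {bs y} → Any (λ b → set b y) bs → set (⋃C bs) y
  ∈⋃C (here p)  = inj₁ p
  ∈⋃C (there p) = inj₂ (∈⋃C p)

  -- A clopen a covered by a family of clopens is covered by finitely many of them:
  -- apply compactness to the family together with the complement of a, indexed by
  -- Maybe I, and discard the complement from the finite subcover.
  clopen-finite-subcover : Compact τ → (a : Clopen τ) {I : Set} (D : I → Clopen τ) →
                           (∀ y → set a y → Σ I (λ i → set (D i) y)) →
                           Σ (List I) (λ is → _⊆C_ τ a (⋃C (map D is)))
  clopen-finite-subcover compact a {I} D covers =
    let js , finite = compact U U-open U-covers
    in catMaybes js , λ y ya → ∈⋃C (Any.map⁺ (dropComplement y ya js (finite y)))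
    where
    U : Maybe I → PSet X
    U (just i) = set (D i)
    U nothing  = co a

    U-open : ∀ m → Open (U m)
    U-open (just i) = set-open (D i)
    U-open nothing  = co-open a

    U-covers : ∀ y → Σ (Maybe I) (λ m → U m y)
    U-covers y with cover a y
    ... | inj₁ ya = just (proj₁ (covers y ya)) , proj₂ (covers y ya)
    ... | inj₂ ca = nothing , ca

    dropComplement : ∀ y → set a y → ∀ ms →
                     Any (λ m → U m y) ms → Any (λ i → set (D i) y) (catMaybes ms)
    dropComplement y ya (just i ∷ ms)  (here p)  = here p
    dropComplement y ya (just i ∷ ms)  (there p) = there (dropComplement y ya ms p)
    dropComplement y ya (nothing ∷ ms) (here p)  = ⊥-elim (disjoint a y ya p)
    dropComplement y ya (nothing ∷ ms) (there p) = dropComplement y ya ms p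

module DualHomProperties (A : ResLattice) {X : Set} (τ : Topology X)
                         (φ : Clopen τ → IFilter A) (dh : DualHom A τ φ) where
  open ClopenAlgebra τ
  open DualHom dh
  open IFilter using (mem; mem-≈; mem-⊤; mem-mp)

  φ-antitone : ∀ {a b} → _⊆C_ τ a b → _⊆F_ A (φ b) (φ a)
  φ-antitone {a} {b} a⊆b u ub =
    proj₁ (proj₁ (dh-∪ a b b ((λ _ → inj₂) , ∪-absorb) u) ub)
    where
    ∪-absorb : ∀ x → set a x ⊎ set b x → set b x
    ∪-absorb x (inj₁ xa) = a⊆b x xa
    ∪-absorb x (inj₂ xb) = xb

  φ-∪⁺ : ∀ a b {u} → mem (φ a) u → mem (φ b) u → mem (φ (a ∪C b)) u
  φ-∪⁺ a b {u} ua ub = proj₂ (dh-∪ a b (a ∪C b) ((λ _ p → p) , (λ _ p → p)) u) (ua , ub)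

  φ-⋃⁺ : ∀ {bs u} → All (λ b → mem (φ b) u) bs → mem (φ (⋃C bs)) u
  φ-⋃⁺ {[]}     {u} []         = dh-∅ emptyC (λ _ ()) u
  φ-⋃⁺ {b ∷ bs}     (ub ∷ ubs) = φ-∪⁺ b (⋃C bs) ub (φ-⋃⁺ ubs)

  φ⊆Fx : ∀ {a x} → set a x → _⊆F_ A (φ a) (Fx A τ φ x)
  φ⊆Fx {a} xa u ua = gen-base ((a , xa) , ua)

  -- The converse of φ⊆Fx: F_x is the union, not merely the join, of the φ(a).
  Fx-witness : ∀ x {u} → mem (Fx A τ φ x) u → Σ (Clopen τ) (λ b → set b x × mem (φ b) u)
  Fx-witness x (gen-base ((a , xa) , ua)) = a , xa , ua
  Fx-witness x (gen-≈ u≈v d) with Fx-witness x d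
  ... | b , xb , ub = b , xb , mem-≈ (φ b) u≈v ub
  Fx-witness x gen-⊤ = fullC , tt , mem-⊤ (φ fullC)
  Fx-witness x (gen-mp d₁ d₂) with Fx-witness x d₁ | Fx-witness x d₂
  ... | b₁ , x₁ , u₁ | b₂ , x₂ , u₂ =
    b₁ ∩C b₂ , (x₁ , x₂) ,
    mem-mp (φ (b₁ ∩C b₂)) (φ-antitone (λ _ → proj₁) _ u₁) (φ-antitone (λ _ → proj₂) _ u₂)

  module _ {x : X} {B : ResLattice} (c : Cocone A τ φ x B) where
    open ResLattice B using (_≈_)
    open Setoid (carrierSetoid B) using (sym)
    open SetoidReasoning (carrierSetoid B)
    open Cocone c using (f; compat)

    cocone-constant : ∀ a (xa : set a x) u → QHom.⟦ f fullC tt ⟧ u ≈ QHom.⟦ f a xa ⟧ u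
    cocone-constant a xa u = sym (compat a fullC (λ _ _ → tt) xa tt u)

    cocone-descends : QHom A (Fx A τ φ x) B
    cocone-descends = record { hom = QHom.hom (f fullC tt) ; respects = respects }
      where
      respects : ∀ {u v} → _≡[_]_ A u (Fx A τ φ x) v →
                 QHom.⟦ f fullC tt ⟧ u ≈ QHom.⟦ f fullC tt ⟧ v
      respects {u} {v} u≡v with Fx-witness x u≡v
      ... | b , xb , u≡[b]v = begin
        QHom.⟦ f fullC tt ⟧ u ≈⟨ cocone-constant b xb u ⟩
        QHom.⟦ f b xb ⟧ u     ≈⟨ QHom.respects (f b xb) u≡[b]v ⟩
        QHom.⟦ f b xb ⟧ v     ≈⟨ cocone-constant b xb v ⟨
        QHom.⟦ f fullC tt ⟧ v ∎

  Fx-isInductiveLimit : ∀ x → IsInductiveLimit A τ φ x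
  Fx-isInductiveLimit x = (λ a xa → φ⊆Fx xa) , λ B c →
    cocone-descends c , cocone-constant c ,
    λ h' h'-factors → h'-factors fullC tt

  ⋂Fx⊆φ : Compact τ → ∀ a u → (∀ x → set a x → mem (Fx A τ φ x) u) → mem (φ a) u
  ⋂Fx⊆φ compact a u u∈Fx =
    let is , a⊆⋃ = clopen-finite-subcover compact a (λ p → proj₁ (witness p)) covers
    in φ-antitone a⊆⋃ u (φ-⋃⁺ (All.map⁺ (All.universal witness-in-φ is)))
    where
    witness : (p : Σ X (set a)) → Σ (Clopen τ) (λ b → set b (proj₁ p) × mem (φ b) u)
    witness (y , ya) = Fx-witness y (u∈Fx y ya)

    witness-in-φ : ∀ p → mem (φ (proj₁ (witness p))) u
    witness-in-φ p = proj₂ (proj₂ (witness p))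

    covers : ∀ y → set a y → Σ (Σ X (set a)) (λ p → set (proj₁ (witness p)) y)
    covers y ya = (y , ya) , proj₁ (proj₂ (witness (y , ya)))

lemma2p8 : (A : ResLattice) → ResLattice.NonTrivial A →
           (X : Set) (τ : Topology X) → BooleanSpace τ →
           (φ : Clopen τ → IFilter A) → DualHom A τ φ →
           (∀ x → IsInductiveLimit A τ φ x) ×
           (∀ a u → ((∀ x → set a x → IFilter.mem (Fx A τ φ x) u) → IFilter.mem (φ a) u) ×
                    (IFilter.mem (φ a) u → ∀ x → set a x → IFilter.mem (Fx A τ φ x) u))
lemma2p8 A _ X τ bs φ dh =
  Fx-isInductiveLimit ,
  λ a u → ⋂Fx⊆φ (BooleanSpace.compact bs) a u , λ ua x xa → φ⊆Fx xa u ua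
  where open DualHomProperties A τ φ dh
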